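{- For each integer $\Delta\ge 2$ and each odd integer $d>0$ there exist a non-negative matrix $A\in\mathbb{Z}_{\ge 0}^{15d\times(15d+6)}$ with $\lVert A\rVert_\infty=\Delta$ and a right-hand side $b\in\mathbb{Z}_{\ge 0}^{15d}$ such that $\mathrm{prox}(A,b)\ge\Delta^{\Theta(d)}$. Furthermore, the underlying ILP is polytopish.
   Context: For $x\in\mathbb{R}^n$ and $Y\subseteq\mathbb{R}^n$ let $\mathrm{dist}(x,Y)=\min_{y\in Y}\lVert x-y\rVert_\infty$, and for $X,Y\subseteq\mathbb{R}^n$ let $\mathrm{dist}(X,Y)=\max_{x\in X}\mathrm{dist}(x,Y)$. For $A\in\mathbb{Z}^{m\times n}$ of full row rank, $b\in\mathbb{Z}^m$ and objective $c\in\mathbb{Z}^n$, let $\mathrm{IntSol}(A,b,c)$ be the set of optimal solutions of $\min\{c^\top x: Ax=b, x\in\mathbb{Z}^n_{\ge0}\}$ and $\mathrm{FracSol}(A,b,c)$ the set of optimal solutions of $\min\{c^\top z: Az=b, z\in\mathbb{Q}^n_{\ge0}\}$. The proximity is $\mathrm{prox}(A,b,c)=\mathrm{dist}(\mathrm{FracSol}(A,b,c),\mathrm{IntSol}(A,b,c))$, and $\mathrm{prox}(A,b)$ denotes this quantity with the zero objective $c=0$. $\Delta$ denotes $\lVert A\rVert_\infty$, the largest absolute value of an entry of $A$. "$\ge\Delta^{\Theta(d)}$" means at least $\Delta^{\gamma d}$ for an absolute constant $\gamma>0$ independent of $\Delta$ and $d$. An ILP $\min\{c^\top x: Ax=b,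 x\in\mathbb{Z}^n_{\ge0}\}$ is called polytopish if there is a polytope $\mathcal{P}$ such that the columns of $A$ are exactly the integer points of $\mathcal{P}$ (each appearing once). -}

module Defs where

open import Data.Nat as ℕ using (ℕ; zero; suc)
open import Data.Integer as ℤ using (ℤ; +_)
open import Data.Rational as ℚ using (ℚ; 0ℚ; 1ℚ; _/_)
open import Data.Fin using (Fin; zero; suc)
open import Data.Product using (Σ; ∃; _×_; _,_)
open import Relation.Binary.PropositionalEquality using (_≡_)
open import Function.Bundles using (_⇔_)

ℤ→ℚ : ℤ → ℚ
ℤ→ℚ z = z / 1

ℕ→ℚ : ℕ → ℚ
ℕ→ℚ n = (+ n) / 1

sumℚ : ∀ {n} → (Fin n → ℚ) → ℚ
sumℚ {zero}  f = 0ℚ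
sumℚ {suc n} f = f zero ℚ.+ sumℚ (λ i → f (suc i))

sumℤ : ∀ {n} → (Fin n → ℤ) → ℤ
sumℤ {zero}  f = + 0
sumℤ {suc n} f = f zero ℤ.+ sumℤ (λ i → f (suc i))

_^ℚ_ : ℚ → ℕ → ℚ
q ^ℚ zero  = 1ℚ
q ^ℚ suc k = q ℚ.* (q ^ℚ k)

Matrix : ℕ → ℕ → Set
Matrix m n = Fin m → Fin n → ℤ

FullRowRank : ∀ {m n} → Matrix m n → Set
FullRowRank {m} {n} A =
  (y : Fin m → ℚ) → (∀ j → sumℚ (λ i → y i ℚ.* ℤ→ℚ (A i j)) ≡ 0ℚ) → ∀ i → y i ≡ 0ℚ

MaxAbsEntry : ∀ {m n} → Matrix m n → ℕ → Set
MaxAbsEntry A Δ = (∀ i j → ℤ.∣ A i j ∣ ℕ.≤ Δ) × (∃ λ i → ∃ λ j → ℤ.∣ A i j ∣ ≡ Δ)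

NonNegMatrix : ∀ {m n} → Matrix m n → Set
NonNegMatrix A = ∀ i j → + 0 ℤ.≤ A i j

NonNegVec : ∀ {m} → (Fin m → ℤ) → Set
NonNegVec b = ∀ i → + 0 ℤ.≤ b i

IntFeasible : ∀ {m n} → Matrix m n → (Fin m → ℤ) → (Fin n → ℤ) → Set
IntFeasible A b x = (∀ j → + 0 ℤ.≤ x j) × (∀ i → sumℤ (λ j → A i j ℤ.* x j) ≡ b i)

FracFeasible : ∀ {m n} → Matrix m n → (Fin m → ℤ) → (Fin n → ℚ) → Set
FracFeasible A b z = (∀ j → 0ℚ ℚ.≤ z j) × (∀ i → sumℚ (λ j → ℤ→ℚ (A i j) ℚ.* z j) ≡ ℤ→ℚ (b i))

IntSol : ∀ {m n} → Matrix m n → (Fin m → ℤ) → (Fin n → ℤ) → (Fin n → ℤ) → Set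
IntSol A b c x = IntFeasible A b x ×
  (∀ y → IntFeasible A b y → sumℤ (λ j → c j ℤ.* x j) ℤ.≤ sumℤ (λ j → c j ℤ.* y j))

FracSol : ∀ {m n} → Matrix m n → (Fin m → ℤ) → (Fin n → ℤ) → (Fin n → ℚ) → Set
FracSol A b c z = FracFeasible A b z ×
  (∀ w → FracFeasible A b w → sumℚ (λ j → ℤ→ℚ (c j) ℚ.* z j) ℚ.≤ sumℚ (λ j → ℤ→ℚ (c j) ℚ.* w j))

zeroObj : ∀ {n} → Fin n → ℤ
zeroObj _ = + 0

-- prox(A,b,c) ≥ e^(p/q)   (p, q ≥ 1 given separately), i.e.
-- IntSol is nonempty (so prox is a finite, well-defined number) and some
-- z ∈ FracSol has ‖z − x‖∞ ≥ e^(p/q) for every x ∈ IntSol.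
-- ‖z − x‖∞ ≥ e^(p/q)  ⇔  ∃ j, |z_j − x_j| ≥ e^(p/q)  ⇔  ∃ j, |z_j − x_j|^q ≥ e^p.
ProxAtLeastPow : ∀ {m n} → Matrix m n → (Fin m → ℤ) → (Fin n → ℤ) → (e p q : ℕ) → Set
ProxAtLeastPow A b c e p q =
  (∃ λ x → IntSol A b c x) ×
  (∃ λ z → FracSol A b c z ×
     (∀ x → IntSol A b c x →
        ∃ λ j → ℕ→ℚ (e ℕ.^ p) ℚ.≤ (ℚ.∣ z j ℚ.- ℤ→ℚ (x j) ∣ ^ℚ q)))

column : ∀ {m n} → Matrix m n → Fin n → Fin m → ℤ
column A j i = A i j

InConvHull : ∀ {k m} → (Fin k → Fin m → ℚ) → (Fin m → ℚ) → Set
InConvHull {k} V y = Σ (Fin k → ℚ) λ λs →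
  (∀ t → 0ℚ ℚ.≤ λs t) × (sumℚ λs ≡ 1ℚ) × (∀ i → sumℚ (λ t → λs t ℚ.* V t i) ≡ y i)

Polytopish : ∀ {m n} → Matrix m n → Set
Polytopish {m} {n} A = Σ ℕ λ k → Σ (Fin k → Fin m → ℚ) λ V →
  ((y : Fin m → ℤ) → InConvHull V (λ i → ℤ→ℚ (y i)) ⇔ (∃ λ j → ∀ i → A i j ≡ y i))
  × (∀ j j′ → (∀ i → A i j ≡ A i j′) → j ≡ j′)

module Submission where

-- A stage [[1,1,0],[0,c,v],[0,0,M]] over a block M with coupling row v = e₀ and right-hand
-- side (r, r, r, …) forces c·x₁ + x₂ = r = x₂ + x₃, so the inner stage's second variable is
-- c times the outer one's. Stacking stages with c = Δ under a top stage with c = 1 makes one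
-- coordinate equal Δ^(K−1)·x₁ in every solution. For b = (Δ^K, …) there is an integral
-- solution with x₁ = 1 and a rational one with x₁ = 1/Δ; as x₁ is integral in every integral
-- solution, the rational one stays at distance ≥ Δ^(K−2) from all of them (and with the zero
-- objective all feasible points are optimal). Polytopishness: the 0/1 first row of a stage
-- splits the hull of its columns into the segment between its two new columns and the hull
-- of the old columns extended by v, so the lattice-point property is proved for v ∷ M by
-- induction, starting from the seven lattice points of a lattice polygon.

open import Defs
open import Data.Nat using (ℕ; _≤_; _*_; _+_; _%_)
open import Data.Fin using (Fin)
open import Data.Integer using (ℤ)
open import Data.Product using (Σ; ∃; _×_)
open import Relation.Binary.PropositionalEquality using (_≡_)
open import Data.Nat using (zero; suc; z≤n; s≤s; _∸_; _^_; _/_; _≤?_)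
import Data.Nat.Properties as ℕP
import Data.Nat.Coprimality as Coprime
import Data.Nat.DivMod as DivMod
import Data.Nat.Solver as ℕSolver
open import Data.Integer as ℤ using (+_; -[1+_]; +≤+)
import Data.Integer.Properties as ℤP
open import Data.Rational as ℚ using (ℚ; mkℚ; 0ℚ; 1ℚ)
import Data.Rational.Properties as ℚP
open import Data.Rational.Solver using (module +-*-Solver)
open import Data.Fin as Fin using (zero; suc)
open import Data.Fin.Patterns using (0F; 1F; 2F; 3F; 4F; 5F; 6F)
open import Data.Fin.Properties using (all?)
open import Data.Vec.Functional using ([]; _∷_; head; tail)
open import Data.Product using (_,_; proj₁; proj₂; uncurry)
open import Data.Sum using (_⊎_; inj₁; inj₂; [_,_]′)
open import Data.Empty using (⊥-elim)
open import Function using (_∘_)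
open import Function.Bundles using (mk⇔)
open import Relation.Binary.PropositionalEquality hiding (_≡_)
open import Relation.Nullary.Decidable using (from-yes)
open import Algebra.Bundles using (AbelianGroup; CommutativeMonoid)
open import Algebra.Properties.CommutativeSemigroup
  (CommutativeMonoid.commutativeSemigroup ℚP.+-0-commutativeMonoid) using () renaming (interchange to +-interchange)
open import Algebra.Properties.Group (AbelianGroup.group ℤP.+-0-abelianGroup) using ()
  renaming (∙-cancelˡ to +-cancelˡ-≡)
open import Algebra.Properties.Group ℚP.+-0-group using ()
  renaming (identityʳ-unique to +-identityʳ-unique)

ℤ→ℚ-mkℚ : ∀ a → ℤ→ℚ a ≡ mkℚ a 0 (Coprime.sym (Coprime.1-coprimeTo ℤ.∣ a ∣))
ℤ→ℚ-mkℚ (+ n)    = ℚP.normalize-coprime (Coprime.sym (Coprime.1-coprimeTo n))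
ℤ→ℚ-mkℚ -[1+ n ] = cong ℚ.-_ (ℚP.normalize-coprime (Coprime.sym (Coprime.1-coprimeTo (suc n))))

ℤ→ℚ-homo-+ : ∀ a b → ℤ→ℚ (a ℤ.+ b) ≡ ℤ→ℚ a ℚ.+ ℤ→ℚ b
ℤ→ℚ-homo-+ a b rewrite ℤ→ℚ-mkℚ a | ℤ→ℚ-mkℚ b =
  cong ℤ→ℚ (cong₂ ℤ._+_ (sym (ℤP.*-identityʳ a)) (sym (ℤP.*-identityʳ b)))

ℤ→ℚ-homo-* : ∀ a b → ℤ→ℚ (a ℤ.* b) ≡ ℤ→ℚ a ℚ.* ℤ→ℚ b
ℤ→ℚ-homo-* a b rewrite ℤ→ℚ-mkℚ a | ℤ→ℚ-mkℚ b = refl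

ℤ→ℚ-homo‿- : ∀ a → ℤ→ℚ (ℤ.- a) ≡ ℚ.- ℤ→ℚ a
ℤ→ℚ-homo‿- (+ zero)  = refl
ℤ→ℚ-homo‿- (+ suc n) = refl
ℤ→ℚ-homo‿- -[1+ n ] rewrite ℤ→ℚ-mkℚ (+ suc n) = refl

ℤ→ℚ-∣∣ : ∀ a → ℚ.∣ ℤ→ℚ a ∣ ≡ ℤ→ℚ (+ ℤ.∣ a ∣)
ℤ→ℚ-∣∣ a rewrite ℤ→ℚ-mkℚ a | ℤ→ℚ-mkℚ (+ ℤ.∣ a ∣) = refl

ℤ→ℚ-mono-≤ : ∀ {a b} → a ℤ.≤ b → ℤ→ℚ a ℚ.≤ ℤ→ℚ b
ℤ→ℚ-mono-≤ {a} {b} a≤b rewrite ℤ→ℚ-mkℚ a | ℤ→ℚ-mkℚ b =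
  ℚ.*≤* (subst₂ ℤ._≤_ (sym (ℤP.*-identityʳ a)) (sym (ℤP.*-identityʳ b)) a≤b)

ℤ→ℚ-cancel-≤ : ∀ {a b} → ℤ→ℚ a ℚ.≤ ℤ→ℚ b → a ℤ.≤ b
ℤ→ℚ-cancel-≤ {a} {b} p rewrite ℤ→ℚ-mkℚ a | ℤ→ℚ-mkℚ b with p
... | ℚ.*≤* q = subst₂ ℤ._≤_ (ℤP.*-identityʳ a) (ℤP.*-identityʳ b) q

ℤ→ℚ-injective : ∀ {a b} → ℤ→ℚ a ≡ ℤ→ℚ b → a ≡ b
ℤ→ℚ-injective e =
  ℤP.≤-antisym (ℤ→ℚ-cancel-≤ (ℚP.≤-reflexive e)) (ℤ→ℚ-cancel-≤ (ℚP.≤-reflexive (sym e)))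

1/suc : ℕ → ℚ
1/suc k = mkℚ (+ 1) k (Coprime.1-coprimeTo _)

ℤ→ℚ-*-1/suc : ∀ k → ℤ→ℚ (+ suc k) ℚ.* 1/suc k ≡ 1ℚ
ℤ→ℚ-*-1/suc k rewrite ℤ→ℚ-mkℚ (+ suc k) =
  ℚP.*-inverseʳ (mkℚ (+ suc k) 0 (Coprime.sym (Coprime.1-coprimeTo (suc k))))

ℤ→ℚ-*-1/suc-cancel : ∀ k a → ℤ→ℚ (+ suc k ℤ.* a) ℚ.* 1/suc k ≡ ℤ→ℚ a
ℤ→ℚ-*-1/suc-cancel k a = begin
  ℤ→ℚ (+ suc k ℤ.* a) ℚ.* 1/suc k
    ≡⟨ cong (ℚ._* 1/suc k) (trans (ℤ→ℚ-homo-* (+ suc k) a) (ℚP.*-comm _ (ℤ→ℚ a))) ⟩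
  ℤ→ℚ a ℚ.* ℤ→ℚ (+ suc k) ℚ.* 1/suc k
    ≡⟨ ℚP.*-assoc (ℤ→ℚ a) (ℤ→ℚ (+ suc k)) (1/suc k) ⟩
  ℤ→ℚ a ℚ.* (ℤ→ℚ (+ suc k) ℚ.* 1/suc k)
    ≡⟨ cong (ℤ→ℚ a ℚ.*_) (ℤ→ℚ-*-1/suc k) ⟩
  ℤ→ℚ a ℚ.* 1ℚ
    ≡⟨ ℚP.*-identityʳ (ℤ→ℚ a) ⟩
  ℤ→ℚ a
    ∎
  where open ≡-Reasoning

sumℚ-cong : ∀ {n} {f g : Fin n → ℚ} → (∀ j → f j ≡ g j) → sumℚ f ≡ sumℚ g
sumℚ-cong {zero}  e = refl
sumℚ-cong {suc n} e = cong₂ ℚ._+_ (e zero) (sumℚ-cong (e ∘ suc))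

sumℤ-zero : ∀ {n} {f : Fin n → ℤ} → (∀ j → f j ≡ + 0) → sumℤ f ≡ + 0
sumℤ-zero {zero}  e = refl
sumℤ-zero {suc n} e = cong₂ ℤ._+_ (e zero) (sumℤ-zero (e ∘ suc))

sumℚ-zero : ∀ {n} {f : Fin n → ℚ} → (∀ j → f j ≡ 0ℚ) → sumℚ f ≡ 0ℚ
sumℚ-zero {zero}  e = refl
sumℚ-zero {suc n} e = cong₂ ℚ._+_ (e zero) (sumℚ-zero (e ∘ suc))

sumℚ-mono-≤ : ∀ {n} {f g : Fin n → ℚ} → (∀ j → f j ℚ.≤ g j) → sumℚ f ℚ.≤ sumℚ g
sumℚ-mono-≤ {zero}  p = ℚP.≤-refl
sumℚ-mono-≤ {suc n} p = ℚP.+-mono-≤ (p zero) (sumℚ-mono-≤ (p ∘ suc))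

sumℚ-nonneg : ∀ {n} {f : Fin n → ℚ} → (∀ j → 0ℚ ℚ.≤ f j) → 0ℚ ℚ.≤ sumℚ f
sumℚ-nonneg {n} {f} p =
  subst (ℚ._≤ sumℚ f) (sumℚ-zero {n} {λ _ → 0ℚ} (λ _ → refl)) (sumℚ-mono-≤ {f = λ _ → 0ℚ} p)

sumℚ-*ʳ : ∀ {n} (f : Fin n → ℚ) r → sumℚ (λ j → f j ℚ.* r) ≡ sumℚ f ℚ.* r
sumℚ-*ʳ {zero}  f r = sym (ℚP.*-zeroˡ r)
sumℚ-*ʳ {suc n} f r = trans (cong (f zero ℚ.* r ℚ.+_) (sumℚ-*ʳ (f ∘ suc) r))
                            (sym (ℚP.*-distribʳ-+ r (f zero) (sumℚ (f ∘ suc))))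

ℤ→ℚ-sumℤ : ∀ {n} (f : Fin n → ℤ) → ℤ→ℚ (sumℤ f) ≡ sumℚ (λ j → ℤ→ℚ (f j))
ℤ→ℚ-sumℤ {zero}  f = refl
ℤ→ℚ-sumℤ {suc n} f =
  trans (ℤ→ℚ-homo-+ (f zero) (sumℤ (f ∘ suc))) (cong (ℤ→ℚ (f zero) ℚ.+_) (ℤ→ℚ-sumℤ (f ∘ suc)))

≤-+ʳ-nonneg : ∀ {a b} → 0ℚ ℚ.≤ b → a ℚ.≤ a ℚ.+ b
≤-+ʳ-nonneg {a} {b} 0≤b = subst (ℚ._≤ a ℚ.+ b) (ℚP.+-identityʳ a) (ℚP.+-monoʳ-≤ a 0≤b)

+-nonneg-≡0 : ∀ {a b} → 0ℚ ℚ.≤ a → 0ℚ ℚ.≤ b → a ℚ.+ b ≡ 0ℚ → a ≡ 0ℚ × b ≡ 0ℚ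
+-nonneg-≡0 {a} {b} 0≤a 0≤b a+b≡0 =
  ℚP.≤-antisym (subst (a ℚ.≤_) a+b≡0 (≤-+ʳ-nonneg 0≤b)) 0≤a ,
  ℚP.≤-antisym (subst (b ℚ.≤_) (trans (ℚP.+-comm b a) a+b≡0) (≤-+ʳ-nonneg 0≤a)) 0≤b

sumℚ-nonneg-≡0 : ∀ {n} {f : Fin n → ℚ} → (∀ j → 0ℚ ℚ.≤ f j) → sumℚ f ≡ 0ℚ → ∀ j → f j ≡ 0ℚ
sumℚ-nonneg-≡0 {suc n} p e zero    = proj₁ (+-nonneg-≡0 (p zero) (sumℚ-nonneg (p ∘ suc)) e)
sumℚ-nonneg-≡0 {suc n} p e (suc j) =
  sumℚ-nonneg-≡0 (p ∘ suc) (proj₂ (+-nonneg-≡0 (p zero) (sumℚ-nonneg (p ∘ suc)) e)) j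

ConvexWeights : ∀ {n} → (Fin n → ℚ) → Set
ConvexWeights l = (∀ t → 0ℚ ℚ.≤ l t) × sumℚ l ≡ 1ℚ

convex-≤ : ∀ {n} {l : Fin n → ℚ} → ConvexWeights l → (f : Fin n → ℚ) {β : ℚ} → (∀ t → f t ℚ.≤ β) →
  sumℚ (λ t → l t ℚ.* f t) ℚ.≤ β
convex-≤ {l = l} (l≥0 , Σl≡1) f {β} f≤β = begin
  sumℚ (λ t → l t ℚ.* f t)  ≤⟨ sumℚ-mono-≤ (λ t → ℚP.*-monoˡ-≤-nonNeg (l t) {{ℚ.nonNegative (l≥0 t)}} (f≤β t)) ⟩
  sumℚ (λ t → l t ℚ.* β)    ≡⟨ sumℚ-*ʳ l β ⟩
  sumℚ l ℚ.* β              ≡⟨ cong (ℚ._* β) Σl≡1 ⟩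
  1ℚ ℚ.* β                  ≡⟨ ℚP.*-identityˡ β ⟩
  β                         ∎
  where open ℚP.≤-Reasoning

convex-nonneg : ∀ {n} {l : Fin n → ℚ} → ConvexWeights l → (f : Fin n → ℚ) → (∀ t → 0ℚ ℚ.≤ f t) →
  0ℚ ℚ.≤ sumℚ (λ t → l t ℚ.* f t)
convex-nonneg {l = l} (l≥0 , _) f f≥0 = sumℚ-nonneg λ t →
  subst (ℚ._≤ l t ℚ.* f t) (ℚP.*-zeroʳ (l t)) (ℚP.*-monoˡ-≤-nonNeg (l t) {{ℚ.nonNegative (l≥0 t)}} (f≥0 t))

_⊙_ : ∀ {n} → (Fin n → ℤ) → (Fin n → ℤ) → ℤ
u ⊙ x = sumℤ (λ j → u j ℤ.* x j)

_⊛_ : ∀ {n} → (Fin n → ℚ) → (Fin n → ℤ) → ℚ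
l ⊛ u = sumℚ (λ t → l t ℚ.* ℤ→ℚ (u t))

infix 8 _⊙_ _⊛_

module _ {n : ℕ} where

  0ᵥ : Fin n → ℤ
  0ᵥ _ = + 0

  ⊙-0ᵥ : (x : Fin n → ℤ) → 0ᵥ ⊙ x ≡ + 0
  ⊙-0ᵥ x = sumℤ-zero (λ j → ℤP.*-zeroˡ (x j))

  ⊙-0ᵥʳ : (u : Fin n → ℤ) → u ⊙ 0ᵥ ≡ + 0
  ⊙-0ᵥʳ u = sumℤ-zero (λ j → ℤP.*-zeroʳ (u j))

  ⊛-0ᵥ : (l : Fin n → ℚ) → l ⊛ 0ᵥ ≡ 0ℚ
  ⊛-0ᵥ l = sumℚ-zero (λ t → ℚP.*-zeroʳ (l t))

  ⊙-0∷ : (u : Fin n → ℤ) (x : Fin (suc n) → ℤ) → (+ 0 ∷ u) ⊙ x ≡ u ⊙ tail x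
  ⊙-0∷ u x = trans (cong (ℤ._+ u ⊙ tail x) (ℤP.*-zeroˡ (head x))) (ℤP.+-identityˡ _)

  ⊙-1∷ : (u : Fin n → ℤ) (x : Fin (suc n) → ℤ) → (+ 1 ∷ u) ⊙ x ≡ head x ℤ.+ u ⊙ tail x
  ⊙-1∷ u x = cong (ℤ._+ u ⊙ tail x) (ℤP.*-identityˡ (head x))

  ⊛-0∷ : (l : Fin (suc n) → ℚ) (u : Fin n → ℤ) → l ⊛ (+ 0 ∷ u) ≡ tail l ⊛ u
  ⊛-0∷ l u = trans (cong (ℚ._+ tail l ⊛ u) (ℚP.*-zeroʳ (head l))) (ℚP.+-identityˡ _)

  ⊛-1∷ : (l : Fin (suc n) → ℚ) (u : Fin n → ℤ) → l ⊛ (+ 1 ∷ u) ≡ head l ℚ.+ tail l ⊛ u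
  ⊛-1∷ l u = cong (ℚ._+ tail l ⊛ u) (ℚP.*-identityʳ (head l))

e₀ : ∀ {n} → Fin (suc n) → ℤ
e₀ = + 1 ∷ 0ᵥ

⊙-e₀ : ∀ {n} (x : Fin (suc n) → ℤ) → e₀ ⊙ x ≡ head x
⊙-e₀ x = trans (⊙-1∷ 0ᵥ x) (trans (cong (ℤ._+_ (head x)) (⊙-0ᵥ (tail x))) (ℤP.+-identityʳ (head x)))

⊛-e₀ : ∀ {n} (l : Fin (suc n) → ℚ) → l ⊛ e₀ ≡ head l
⊛-e₀ l = trans (⊛-1∷ l 0ᵥ) (trans (cong (head l ℚ.+_) (⊛-0ᵥ (tail l))) (ℚP.+-identityʳ (head l)))

stage : ∀ {m n} → ℤ → Matrix m n → (Fin n → ℤ) → Matrix (suc (suc m)) (suc (suc n))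
stage c M v = (+ 1 ∷ + 1 ∷ 0ᵥ) ∷ (+ 0 ∷ c ∷ v) ∷ (λ i → + 0 ∷ + 0 ∷ M i)

module _ {m n} (c : ℤ) (M : Matrix m n) (v : Fin n → ℤ) where

  stage-row₀-⊙ : ∀ x → stage c M v zero ⊙ x ≡ x zero ℤ.+ x (suc zero)
  stage-row₀-⊙ x = begin
    (+ 1 ∷ + 1 ∷ 0ᵥ) ⊙ x
      ≡⟨ ⊙-1∷ (+ 1 ∷ 0ᵥ) x ⟩
    x zero ℤ.+ (+ 1 ∷ 0ᵥ) ⊙ tail x
      ≡⟨ cong (λ s → x zero ℤ.+ s) (⊙-1∷ 0ᵥ (tail x)) ⟩
    x zero ℤ.+ (x (suc zero) ℤ.+ 0ᵥ ⊙ tail (tail x))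
      ≡⟨ cong (λ s → x zero ℤ.+ (x (suc zero) ℤ.+ s)) (⊙-0ᵥ (tail (tail x))) ⟩
    x zero ℤ.+ (x (suc zero) ℤ.+ + 0)
      ≡⟨ cong (λ s → x zero ℤ.+ s) (ℤP.+-identityʳ _) ⟩
    x zero ℤ.+ x (suc zero)
      ∎
    where open ≡-Reasoning

  stage-row₁-⊙ : ∀ x → stage c M v (suc zero) ⊙ x ≡ c ℤ.* x (suc zero) ℤ.+ v ⊙ tail (tail x)
  stage-row₁-⊙ x = ⊙-0∷ (c ∷ v) x

  stage-rowᵣ-⊙ : ∀ i x → stage c M v (suc (suc i)) ⊙ x ≡ M i ⊙ tail (tail x)
  stage-rowᵣ-⊙ i x = trans (⊙-0∷ (+ 0 ∷ M i) x) (⊙-0∷ (M i) (tail x))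

  stage-row₀-⊛ : ∀ l → l ⊛ stage c M v zero ≡ l zero ℚ.+ l (suc zero)
  stage-row₀-⊛ l = begin
    l ⊛ (+ 1 ∷ + 1 ∷ 0ᵥ)
      ≡⟨ ⊛-1∷ l (+ 1 ∷ 0ᵥ) ⟩
    l zero ℚ.+ tail l ⊛ (+ 1 ∷ 0ᵥ)
      ≡⟨ cong (l zero ℚ.+_) (⊛-1∷ (tail l) 0ᵥ) ⟩
    l zero ℚ.+ (l (suc zero) ℚ.+ tail (tail l) ⊛ 0ᵥ)
      ≡⟨ cong (λ s → l zero ℚ.+ (l (suc zero) ℚ.+ s)) (⊛-0ᵥ (tail (tail l))) ⟩
    l zero ℚ.+ (l (suc zero) ℚ.+ 0ℚ)
      ≡⟨ cong (l zero ℚ.+_) (ℚP.+-identityʳ _) ⟩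
    l zero ℚ.+ l (suc zero)
      ∎
    where open ≡-Reasoning

  stage-row₁-⊛ : ∀ l → l ⊛ stage c M v (suc zero) ≡ l (suc zero) ℚ.* ℤ→ℚ c ℚ.+ tail (tail l) ⊛ v
  stage-row₁-⊛ l = ⊛-0∷ l (c ∷ v)

  stage-rowᵣ-⊛ : ∀ i l → l ⊛ stage c M v (suc (suc i)) ≡ tail (tail l) ⊛ M i
  stage-rowᵣ-⊛ i l = trans (⊛-0∷ l (+ 0 ∷ M i)) (⊛-0∷ (tail l) (M i))

  stage-col₀-⊛ : ∀ y → y ⊛ column (stage c M v) zero ≡ y zero
  stage-col₀-⊛ y = begin
    y ⊛ (+ 1 ∷ + 0 ∷ 0ᵥ)            ≡⟨ ⊛-1∷ y (+ 0 ∷ 0ᵥ) ⟩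
    y zero ℚ.+ tail y ⊛ (+ 0 ∷ 0ᵥ)  ≡⟨ cong (y zero ℚ.+_) (trans (⊛-0∷ (tail y) 0ᵥ) (⊛-0ᵥ (tail (tail y)))) ⟩
    y zero ℚ.+ 0ℚ                   ≡⟨ ℚP.+-identityʳ (y zero) ⟩
    y zero                          ∎
    where open ≡-Reasoning

  stage-col₁-⊛ : ∀ y → y ⊛ column (stage c M v) (suc zero) ≡ y zero ℚ.+ y (suc zero) ℚ.* ℤ→ℚ c
  stage-col₁-⊛ y = trans (⊛-1∷ y (c ∷ 0ᵥ)) (cong (y zero ℚ.+_) (begin
    y (suc zero) ℚ.* ℤ→ℚ c ℚ.+ tail (tail y) ⊛ 0ᵥ  ≡⟨ cong (y (suc zero) ℚ.* ℤ→ℚ c ℚ.+_) (⊛-0ᵥ (tail (tail y))) ⟩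
    y (suc zero) ℚ.* ℤ→ℚ c ℚ.+ 0ℚ                  ≡⟨ ℚP.+-identityʳ _ ⟩
    y (suc zero) ℚ.* ℤ→ℚ c                         ∎))
    where open ≡-Reasoning

  stage-colᵣ-⊛ : ∀ j y → y ⊛ column (stage c M v) (suc (suc j)) ≡
    y (suc zero) ℚ.* ℤ→ℚ (v j) ℚ.+ tail (tail y) ⊛ column M j
  stage-colᵣ-⊛ j y = ⊛-0∷ y (v j ∷ column M j)

*-ℤ→ℚ-suc-≡0 : ∀ k {y} → y ℚ.* ℤ→ℚ (+ suc k) ≡ 0ℚ → y ≡ 0ℚ
*-ℤ→ℚ-suc-≡0 k {y} yc≡0 = begin
  y                                  ≡⟨ sym (ℚP.*-identityʳ y) ⟩
  y ℚ.* 1ℚ                           ≡⟨ cong (y ℚ.*_) (sym (ℤ→ℚ-*-1/suc k)) ⟩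
  y ℚ.* (ℤ→ℚ (+ suc k) ℚ.* 1/suc k)  ≡⟨ sym (ℚP.*-assoc y _ _) ⟩
  (y ℚ.* ℤ→ℚ (+ suc k)) ℚ.* 1/suc k  ≡⟨ cong (ℚ._* 1/suc k) yc≡0 ⟩
  0ℚ ℚ.* 1/suc k                     ≡⟨ ℚP.*-zeroˡ (1/suc k) ⟩
  0ℚ                                 ∎
  where open ≡-Reasoning

stage-fullRowRank : ∀ {m n} k (M : Matrix m n) v → FullRowRank M → FullRowRank (stage (+ suc k) M v)
stage-fullRowRank k M v frr y ⊥y = λ where
    zero          → y₀≡0
    (suc zero)    → y₁≡0
    (suc (suc i)) → frr (tail (tail y)) rest i
  where
  c = + suc k
  y₀≡0 : y zero ≡ 0ℚ
  y₀≡0 = trans (sym (stage-col₀-⊛ c M v y)) (⊥y zero)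
  y₁≡0 : y (suc zero) ≡ 0ℚ
  y₁≡0 = *-ℤ→ℚ-suc-≡0 k (begin
    y (suc zero) ℚ.* ℤ→ℚ c               ≡⟨ sym (ℚP.+-identityˡ _) ⟩
    0ℚ ℚ.+ y (suc zero) ℚ.* ℤ→ℚ c        ≡⟨ cong (λ a → a ℚ.+ y (suc zero) ℚ.* ℤ→ℚ c) (sym y₀≡0) ⟩
    y zero ℚ.+ y (suc zero) ℚ.* ℤ→ℚ c    ≡⟨ sym (stage-col₁-⊛ c M v y) ⟩
    y ⊛ column (stage c M v) (suc zero)  ≡⟨ ⊥y (suc zero) ⟩
    0ℚ                                   ∎)
    where open ≡-Reasoning
  rest : ∀ j → tail (tail y) ⊛ column M j ≡ 0ℚ
  rest j = begin
    tail (tail y) ⊛ column M j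
      ≡⟨ sym (ℚP.+-identityˡ _) ⟩
    0ℚ ℚ.+ tail (tail y) ⊛ column M j
      ≡⟨ cong (ℚ._+ tail (tail y) ⊛ column M j) (sym (trans (cong (ℚ._* ℤ→ℚ (v j)) y₁≡0) (ℚP.*-zeroˡ (ℤ→ℚ (v j))))) ⟩
    y (suc zero) ℚ.* ℤ→ℚ (v j) ℚ.+ tail (tail y) ⊛ column M j
      ≡⟨ sym (stage-colᵣ-⊛ c M v j y) ⟩
    y ⊛ column (stage c M v) (suc (suc j))
      ≡⟨ ⊥y (suc (suc j)) ⟩
    0ℚ ∎
    where open ≡-Reasoning

columnsℚ : ∀ {m n} → Matrix m n → Fin n → Fin m → ℚ
columnsℚ A t i = ℤ→ℚ (A i t)

LatticeClosed : ∀ {m n} → Matrix m n → Set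
LatticeClosed {m} A =
  (y : Fin m → ℤ) → InConvHull (columnsℚ A) (λ i → ℤ→ℚ (y i)) → ∃ λ j → ∀ i → A i j ≡ y i

DistinctColumns : ∀ {m n} → Matrix m n → Set
DistinctColumns A = ∀ j j′ → (∀ i → A i j ≡ A i j′) → j ≡ j′

unitℚ : ∀ {n} → Fin n → Fin n → ℚ
unitℚ zero    = 1ℚ ∷ λ _ → 0ℚ
unitℚ (suc j) = 0ℚ ∷ unitℚ j

unitℚ-nonneg : ∀ {n} (j t : Fin n) → 0ℚ ℚ.≤ unitℚ j t
unitℚ-nonneg zero    zero    = ℚ.*≤* (+≤+ z≤n)
unitℚ-nonneg zero    (suc t) = ℚP.≤-refl
unitℚ-nonneg (suc j) zero    = ℚP.≤-refl
unitℚ-nonneg (suc j) (suc t) = unitℚ-nonneg j t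

sumℚ-unitℚ-* : ∀ {n} (j : Fin n) (f : Fin n → ℚ) → sumℚ (λ t → unitℚ j t ℚ.* f t) ≡ f j
sumℚ-unitℚ-* zero    f = begin
  1ℚ ℚ.* f zero ℚ.+ sumℚ (λ t → 0ℚ ℚ.* f (suc t))
    ≡⟨ cong₂ ℚ._+_ (ℚP.*-identityˡ (f zero)) (sumℚ-zero (λ t → ℚP.*-zeroˡ (f (suc t)))) ⟩
  f zero ℚ.+ 0ℚ
    ≡⟨ ℚP.+-identityʳ (f zero) ⟩
  f zero
    ∎
  where open ≡-Reasoning
sumℚ-unitℚ-* (suc j) f = begin
  0ℚ ℚ.* f zero ℚ.+ sumℚ (λ t → unitℚ j t ℚ.* f (suc t))
    ≡⟨ cong₂ ℚ._+_ (ℚP.*-zeroˡ (f zero)) (sumℚ-unitℚ-* j (f ∘ suc)) ⟩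
  0ℚ ℚ.+ f (suc j)
    ≡⟨ ℚP.+-identityˡ (f (suc j)) ⟩
  f (suc j)
    ∎
  where open ≡-Reasoning

column-inConvHull : ∀ {m n} (A : Matrix m n) {y : Fin m → ℤ} → (∃ λ j → ∀ i → A i j ≡ y i) →
  InConvHull (columnsℚ A) (λ i → ℤ→ℚ (y i))
column-inConvHull A (j , Aj≡y) = unitℚ j , unitℚ-nonneg j ,
  trans (sumℚ-cong (λ t → sym (ℚP.*-identityʳ (unitℚ j t)))) (sumℚ-unitℚ-* j (λ _ → 1ℚ)) ,
  λ i → trans (sumℚ-unitℚ-* j (λ t → columnsℚ A t i)) (cong ℤ→ℚ (Aj≡y i))

polytopish : ∀ {m n} (A : Matrix m n) → LatticeClosed A → DistinctColumns A → Polytopish A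
polytopish {n = n} A closed distinct =
  n , columnsℚ A , (λ y → mk⇔ (closed y) (column-inConvHull A {y})) , distinct

0≤a≤1⇒a≡0⊎a≡1 : ∀ {a} → + 0 ℤ.≤ a → a ℤ.≤ + 1 → a ≡ + 0 ⊎ a ≡ + 1
0≤a≤1⇒a≡0⊎a≡1 {+ zero}          _ _                  = inj₁ refl
0≤a≤1⇒a≡0⊎a≡1 {+ suc zero}      _ _                  = inj₂ refl
0≤a≤1⇒a≡0⊎a≡1 {+ suc (suc n)}   _ (+≤+ (s≤s ()))

integral-weight : ∀ {p q a} → 0ℚ ℚ.≤ p → 0ℚ ℚ.≤ q → p ℚ.+ q ≡ 1ℚ → p ≡ ℤ→ℚ a → a ≡ + 0 ⊎ a ≡ + 1
integral-weight {p} 0≤p 0≤q p+q≡1 p≡a = 0≤a≤1⇒a≡0⊎a≡1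
  (ℤ→ℚ-cancel-≤ (subst (0ℚ ℚ.≤_) p≡a 0≤p))
  (ℤ→ℚ-cancel-≤ (subst (ℚ._≤ 1ℚ) p≡a (subst (p ℚ.≤_) p+q≡1 (≤-+ʳ-nonneg 0≤q))))

convex-integral-bounds : ∀ {n} {l : Fin n → ℚ} → ConvexWeights l → (u : Fin n → ℤ) {β : ℤ} →
  (∀ t → + 0 ℤ.≤ u t) → (∀ t → u t ℤ.≤ β) → ∀ {a} → l ⊛ u ≡ ℤ→ℚ a → + 0 ℤ.≤ a × a ℤ.≤ β
convex-integral-bounds cw u u≥0 u≤β l⊛u≡a =
  ℤ→ℚ-cancel-≤ (subst (0ℚ ℚ.≤_) l⊛u≡a (convex-nonneg cw _ (ℤ→ℚ-mono-≤ ∘ u≥0))) ,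
  ℤ→ℚ-cancel-≤ (subst (ℚ._≤ _) l⊛u≡a (convex-≤ cw _ (ℤ→ℚ-mono-≤ ∘ u≤β)))

⊛-+ : ∀ {n} (l : Fin n → ℚ) (u w : Fin n → ℤ) → l ⊛ (λ t → u t ℤ.+ w t) ≡ l ⊛ u ℚ.+ l ⊛ w
⊛-+ {zero}  l u w = refl
⊛-+ {suc n} l u w = begin
  l zero ℚ.* ℤ→ℚ (u zero ℤ.+ w zero) ℚ.+ tail l ⊛ (λ t → u (suc t) ℤ.+ w (suc t))
    ≡⟨ cong₂ ℚ._+_ (trans (cong (l zero ℚ.*_) (ℤ→ℚ-homo-+ (u zero) (w zero))) (ℚP.*-distribˡ-+ (l zero) _ _))
                    (⊛-+ (tail l) (tail u) (tail w)) ⟩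
  (l zero ℚ.* ℤ→ℚ (u zero) ℚ.+ l zero ℚ.* ℤ→ℚ (w zero)) ℚ.+ (tail l ⊛ tail u ℚ.+ tail l ⊛ tail w)
    ≡⟨ +-interchange (l zero ℚ.* ℤ→ℚ (u zero)) (l zero ℚ.* ℤ→ℚ (w zero)) (tail l ⊛ tail u) (tail l ⊛ tail w) ⟩
  l ⊛ u ℚ.+ l ⊛ w
    ∎
  where open ≡-Reasoning

column-∷ : ∀ {m n} {u : Fin n → ℤ} {M : Matrix m n} {j : Fin n} {y : Fin (suc m) → ℤ} →
  u j ≡ y zero → (∀ i → M i j ≡ y (suc i)) → ∀ i → (u ∷ M) i j ≡ y i
column-∷ head≡ tail≡ zero    = head≡
column-∷ head≡ tail≡ (suc i) = tail≡ i

module StageHull {m n} (c : ℤ) (M : Matrix m n) (v : Fin n → ℤ)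
  {l : Fin (suc (suc n)) → ℚ} (cw : ConvexWeights l)
  (y : Fin (suc (suc m)) → ℤ) (hull : ∀ i → l ⊛ stage c M v i ≡ ℤ→ℚ (y i)) where

  private
    l₀ = l zero
    l₁ = l (suc zero)
    L = tail (tail l)
    l₀+l₁≡y₀ : l₀ ℚ.+ l₁ ≡ ℤ→ℚ (y zero)
    l₀+l₁≡y₀ = trans (sym (stage-row₀-⊛ c M v l)) (hull zero)
    Σl≡1 : (l₀ ℚ.+ l₁) ℚ.+ sumℚ L ≡ 1ℚ
    Σl≡1 = trans (ℚP.+-assoc l₀ l₁ (sumℚ L)) (proj₂ cw)

  y₀≡0⊎y₀≡1 : y zero ≡ + 0 ⊎ y zero ≡ + 1
  y₀≡0⊎y₀≡1 = uncurry 0≤a≤1⇒a≡0⊎a≡1 (convex-integral-bounds cw (stage c M v zero)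
    (λ where zero → +≤+ z≤n ; (suc zero) → +≤+ z≤n ; (suc (suc _)) → +≤+ z≤n)
    (λ where zero → ℤP.≤-refl ; (suc zero) → ℤP.≤-refl ; (suc (suc _)) → +≤+ z≤n) (hull zero))

  lower-face : LatticeClosed (v ∷ M) → y zero ≡ + 0 →
    l₀ ≡ 0ℚ × ∃ λ j → ∀ i → stage c M v i (suc (suc j)) ≡ y i
  lower-face closed y₀≡0 = l₀≡0 , j , column-∷ {y = y} (sym y₀≡0) (column-∷ {y = tail y} (col zero) (col ∘ suc))
    where
    l₀≡0×l₁≡0 = +-nonneg-≡0 (proj₁ cw zero) (proj₁ cw (suc zero)) (trans l₀+l₁≡y₀ (cong ℤ→ℚ y₀≡0))
    l₀≡0 = proj₁ l₀≡0×l₁≡0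
    l₁≡0 = proj₂ l₀≡0×l₁≡0
    ΣL≡1 : sumℚ L ≡ 1ℚ
    ΣL≡1 = trans (sym (ℚP.+-identityˡ (sumℚ L)))
      (trans (cong (ℚ._+ sumℚ L) (sym (trans (cong₂ ℚ._+_ l₀≡0 l₁≡0) refl))) Σl≡1)
    y′ : Fin (suc m) → ℤ
    y′ = y (suc zero) ∷ tail (tail y)
    L-hull : ∀ i → L ⊛ (v ∷ M) i ≡ ℤ→ℚ (y′ i)
    L-hull zero = begin
      L ⊛ v
        ≡⟨ sym (ℚP.+-identityˡ (L ⊛ v)) ⟩
      0ℚ ℚ.+ L ⊛ v
        ≡⟨ cong (ℚ._+ L ⊛ v) (sym (trans (cong (ℚ._* ℤ→ℚ c) l₁≡0) (ℚP.*-zeroˡ (ℤ→ℚ c)))) ⟩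
      l₁ ℚ.* ℤ→ℚ c ℚ.+ L ⊛ v
        ≡⟨ sym (stage-row₁-⊛ c M v l) ⟩
      l ⊛ stage c M v (suc zero)
        ≡⟨ hull (suc zero) ⟩
      ℤ→ℚ (y (suc zero))
        ∎
      where open ≡-Reasoning
    L-hull (suc i) = trans (sym (stage-rowᵣ-⊛ c M v i l)) (hull (suc (suc i)))
    found = closed y′ (L , (λ t → proj₁ cw (suc (suc t))) , ΣL≡1 , L-hull)
    j = proj₁ found
    col : ∀ i → (v ∷ M) i j ≡ y′ i
    col = proj₂ found

  upper-face : y zero ≡ + 1 →
    l₀ ℚ.+ l₁ ≡ 1ℚ × l₁ ℚ.* ℤ→ℚ c ≡ ℤ→ℚ (y (suc zero)) × (∀ i → + 0 ≡ y (suc (suc i)))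
  upper-face y₀≡1 = l₀+l₁≡1 , row₁ , rowᵣ
    where
    l₀+l₁≡1 = trans l₀+l₁≡y₀ (cong ℤ→ℚ y₀≡1)
    L≡0 : ∀ t → L t ≡ 0ℚ
    L≡0 = sumℚ-nonneg-≡0 (λ t → proj₁ cw (suc (suc t)))
      (+-identityʳ-unique 1ℚ (sumℚ L) (trans (cong (ℚ._+ sumℚ L) (sym l₀+l₁≡1)) Σl≡1))
    L⊛≡0 : ∀ u → L ⊛ u ≡ 0ℚ
    L⊛≡0 u = sumℚ-zero (λ t → trans (cong (ℚ._* ℤ→ℚ (u t)) (L≡0 t)) (ℚP.*-zeroˡ (ℤ→ℚ (u t))))
    row₁ : l₁ ℚ.* ℤ→ℚ c ≡ ℤ→ℚ (y (suc zero))
    row₁ = begin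
      l₁ ℚ.* ℤ→ℚ c                ≡⟨ sym (ℚP.+-identityʳ _) ⟩
      l₁ ℚ.* ℤ→ℚ c ℚ.+ 0ℚ         ≡⟨ cong (l₁ ℚ.* ℤ→ℚ c ℚ.+_) (sym (L⊛≡0 v)) ⟩
      l₁ ℚ.* ℤ→ℚ c ℚ.+ L ⊛ v      ≡⟨ sym (stage-row₁-⊛ c M v l) ⟩
      l ⊛ stage c M v (suc zero)  ≡⟨ hull (suc zero) ⟩
      ℤ→ℚ (y (suc zero))          ∎
      where open ≡-Reasoning
    rowᵣ : ∀ i → + 0 ≡ y (suc (suc i))
    rowᵣ i = ℤ→ℚ-injective (trans (sym (L⊛≡0 (M i))) (trans (sym (stage-rowᵣ-⊛ c M v i l)) (hull (suc (suc i)))))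


+≡1⇒complement : ∀ {l₀ l₁} → l₀ ℚ.+ l₁ ≡ 1ℚ → (l₀ ≡ 0ℚ → l₁ ≡ 1ℚ) × (l₀ ≡ 1ℚ → l₁ ≡ 0ℚ)
+≡1⇒complement {l₀} {l₁} l₀+l₁≡1 =
  (λ l₀≡0 → trans (sym (ℚP.+-identityˡ l₁)) (trans (cong (ℚ._+ l₁) (sym l₀≡0)) l₀+l₁≡1)) ,
  (λ l₀≡1 → +-identityʳ-unique 1ℚ l₁ (trans (cong (ℚ._+ l₁) (sym l₀≡1)) l₀+l₁≡1))

scale-by-0-or-1 : ∀ {l₁ c a} → l₁ ℚ.* ℤ→ℚ c ≡ ℤ→ℚ a →
  (l₁ ≡ 0ℚ → + 0 ≡ a) × (l₁ ≡ 1ℚ → c ≡ a)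
scale-by-0-or-1 {l₁} {c} l₁c≡a =
  (λ l₁≡0 → ℤ→ℚ-injective (trans (sym (trans (cong (ℚ._* ℤ→ℚ c) l₁≡0) (ℚP.*-zeroˡ (ℤ→ℚ c)))) l₁c≡a)) ,
  (λ l₁≡1 → ℤ→ℚ-injective (trans (sym (trans (cong (ℚ._* ℤ→ℚ c) l₁≡1) (ℚP.*-identityˡ (ℤ→ℚ c)))) l₁c≡a))

stage-latticeClosed : ∀ {m n} c (M : Matrix m n) v → LatticeClosed (v ∷ M) → LatticeClosed (e₀ ∷ stage c M v)
stage-latticeClosed c M v closed y (l , l≥0 , Σl≡1 , hull) = [ lower , upper ]′ y₀≡0⊎y₀≡1
  where
  open StageHull c M v (l≥0 , Σl≡1) (tail y) (hull ∘ suc)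
  Goal = ∃ λ j → ∀ i → (e₀ ∷ stage c M v) i j ≡ y i
  l₀≡tag : l zero ≡ ℤ→ℚ (y zero)
  l₀≡tag = trans (sym (⊛-e₀ l)) (hull zero)
  lower : y (suc zero) ≡ + 0 → Goal
  lower y₀≡0 with lower-face closed y₀≡0
  ... | l₀≡0 , j , col = suc (suc j) , column-∷ {y = y} (ℤ→ℚ-injective (trans (sym l₀≡0) l₀≡tag)) col
  upper : y (suc zero) ≡ + 1 → Goal
  upper y₀≡1 with upper-face y₀≡1
  ... | l₀+l₁≡1 , row₁ , rowᵣ with integral-weight (l≥0 zero) (l≥0 (suc zero)) l₀+l₁≡1 l₀≡tag
  ... | inj₁ tag≡0 = suc zero ,
    column-∷ {y = y} (sym tag≡0) (column-∷ {y = tail y} (sym y₀≡1) (column-∷ {y = tail (tail y)} c≡y₁ rowᵣ))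
    where
    l₁≡1 = proj₁ (+≡1⇒complement l₀+l₁≡1) (trans l₀≡tag (cong ℤ→ℚ tag≡0))
    c≡y₁ = proj₂ (scale-by-0-or-1 {c = c} row₁) l₁≡1
  ... | inj₂ tag≡1 = zero ,
    column-∷ {y = y} (sym tag≡1) (column-∷ {y = tail y} (sym y₀≡1) (column-∷ {y = tail (tail y)} 0≡y₁ rowᵣ))
    where
    l₁≡0 = proj₂ (+≡1⇒complement l₀+l₁≡1) (trans l₀≡tag (cong ℤ→ℚ tag≡1))
    0≡y₁ = proj₁ (scale-by-0-or-1 {c = c} row₁) l₁≡0

top-latticeClosed : ∀ {m n} (M : Matrix m n) v → LatticeClosed (v ∷ M) → LatticeClosed (stage (+ 1) M v)
top-latticeClosed M v closed y (l , l≥0 , Σl≡1 , hull) = [ lower , upper ]′ y₀≡0⊎y₀≡1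
  where
  open StageHull (+ 1) M v (l≥0 , Σl≡1) y hull
  Goal = ∃ λ j → ∀ i → stage (+ 1) M v i j ≡ y i
  lower : y zero ≡ + 0 → Goal
  lower y₀≡0 = let _ , j , col = lower-face closed y₀≡0 in suc (suc j) , col
  upper : y zero ≡ + 1 → Goal
  upper y₀≡1 with upper-face y₀≡1
  ... | l₀+l₁≡1 , row₁ , rowᵣ
    with integral-weight (l≥0 (suc zero)) (l≥0 zero) (trans (ℚP.+-comm (l (suc zero)) (l zero)) l₀+l₁≡1)
                         (trans (sym (ℚP.*-identityʳ (l (suc zero)))) row₁)
  ... | inj₁ y₁≡0 = zero , column-∷ {y = y} (sym y₀≡1) (column-∷ {y = tail y} (sym y₁≡0) rowᵣ)
  ... | inj₂ y₁≡1 = suc zero , column-∷ {y = y} (sym y₀≡1) (column-∷ {y = tail y} (sym y₁≡1) rowᵣ)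

∷-distinctColumns : ∀ {m n} (u : Fin n → ℤ) (A : Matrix m n) → DistinctColumns A → DistinctColumns (u ∷ A)
∷-distinctColumns u A distinct j j′ same = distinct j j′ (same ∘ suc)

+1≢+0 : + 1 ≢ + 0
+1≢+0 ()

stage-distinctColumns : ∀ {m n} c (M : Matrix m n) v → c ≢ + 0 → DistinctColumns (v ∷ M) →
  DistinctColumns (stage c M v)
stage-distinctColumns c M v c≢0 distinct = λ where
  zero          zero           same → refl
  zero          (suc zero)     same → ⊥-elim (c≢0 (sym (same (suc zero))))
  zero          (suc (suc j′)) same → ⊥-elim (+1≢+0 (same zero))
  (suc zero)    zero           same → ⊥-elim (c≢0 (same (suc zero)))
  (suc zero)    (suc zero)     same → refl
  (suc zero)    (suc (suc j′)) same → ⊥-elim (+1≢+0 (same zero))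
  (suc (suc j)) zero           same → ⊥-elim (+1≢+0 (sym (same zero)))
  (suc (suc j)) (suc zero)     same → ⊥-elim (+1≢+0 (sym (same zero)))
  (suc (suc j)) (suc (suc j′)) same → cong (λ t → suc (suc t)) (distinct j j′ (λ where
    zero    → same (suc zero)
    (suc i) → same (suc (suc i))))

Entrywise : (ℤ → Set) → ∀ {m n} → Matrix m n → Set
Entrywise P A = ∀ i j → P (A i j)

stage-entrywise : ∀ {P : ℤ → Set} {m n} c (M : Matrix m n) v → P (+ 0) → P (+ 1) → P c →
  Entrywise P (v ∷ M) → Entrywise P (e₀ ∷ stage c M v)
stage-entrywise c M v P0 P1 Pc PvM = λ where
  zero                   zero          → P1
  zero                   (suc _)       → P0
  (suc zero)             zero          → P1
  (suc zero)             (suc zero)    → P1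
  (suc zero)             (suc (suc _)) → P0
  (suc (suc zero))       zero          → P0
  (suc (suc zero))       (suc zero)    → Pc
  (suc (suc zero))       (suc (suc j)) → PvM zero j
  (suc (suc (suc i)))    zero          → P0
  (suc (suc (suc i)))    (suc zero)    → P0
  (suc (suc (suc i)))    (suc (suc j)) → PvM (suc i) j

-- The columns (baseRowℕ j, baseTagℕ j) are the lattice points of {0 ≤ a, 0 ≤ b ≤ 2, 2a + b ≤ 4}.
baseRowℕ baseTagℕ : Fin 7 → ℕ
baseRowℕ = 0 ∷ 0 ∷ 0 ∷ 1 ∷ 1 ∷ 1 ∷ 2 ∷ []
baseTagℕ = 0 ∷ 1 ∷ 2 ∷ 0 ∷ 1 ∷ 2 ∷ 0 ∷ []

base : Matrix 1 7
base = (λ j → + baseRowℕ j) ∷ []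

baseTag : Fin 7 → ℤ
baseTag j = + baseTagℕ j

basePoint : ℕ → ℕ → Fin 7
basePoint 0 0 = 0F
basePoint 0 1 = 1F
basePoint 0 2 = 2F
basePoint 1 0 = 3F
basePoint 1 1 = 4F
basePoint 1 2 = 5F
basePoint _ _ = 6F

basePoint-inverse : ∀ j → basePoint (baseRowℕ j) (baseTagℕ j) ≡ j
basePoint-inverse = from-yes (all? λ j → basePoint (baseRowℕ j) (baseTagℕ j) Fin.≟ j)

basePoint-correct : ∀ {a b} → a ≤ 2 → b ≤ 2 → a + a + b ≤ 4 →
  baseRowℕ (basePoint a b) ≡ a × baseTagℕ (basePoint a b) ≡ b
basePoint-correct {0} {0} _ _ _ = refl , refl
basePoint-correct {0} {1} _ _ _ = refl , refl
basePoint-correct {0} {2} _ _ _ = refl , refl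
basePoint-correct {1} {0} _ _ _ = refl , refl
basePoint-correct {1} {1} _ _ _ = refl , refl
basePoint-correct {1} {2} _ _ _ = refl , refl
basePoint-correct {2} {0} _ _ _ = refl , refl
basePoint-correct {2} {suc b} _ _ (s≤s (s≤s (s≤s (s≤s ()))))
basePoint-correct {suc (suc (suc a))} (s≤s (s≤s ())) _ _
basePoint-correct {_} {suc (suc (suc b))} _ (s≤s (s≤s ())) _

basePoint-correctℤ : ∀ {a b} → + 0 ℤ.≤ a → a ℤ.≤ + 2 → + 0 ℤ.≤ b → b ℤ.≤ + 2 →
  (a ℤ.+ a) ℤ.+ b ℤ.≤ + 4 →
  + baseRowℕ (basePoint ℤ.∣ a ∣ ℤ.∣ b ∣) ≡ a × + baseTagℕ (basePoint ℤ.∣ a ∣ ℤ.∣ b ∣) ≡ b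
basePoint-correctℤ {+ a} {+ b} _ (+≤+ a≤2) _ (+≤+ b≤2) (+≤+ a+a+b≤4) =
  cong +_ (proj₁ correct) , cong +_ (proj₂ correct)
  where correct = basePoint-correct a≤2 b≤2 a+a+b≤4

base-latticeClosed : LatticeClosed (baseTag ∷ base)
base-latticeClosed y (l , l≥0 , Σl≡1 , hull) =
  basePoint ℤ.∣ a ∣ ℤ.∣ b ∣ , column-∷ {y = y} (proj₂ correct) (column-∷ {y = tail y} (proj₁ correct) λ ())
  where
  cw = l≥0 , Σl≡1
  row = base zero
  a = y (suc zero)
  b = y zero
  facetRow : Fin 7 → ℤ
  facetRow t = (row t ℤ.+ row t) ℤ.+ baseTag t
  facetEq : l ⊛ facetRow ≡ ℤ→ℚ ((a ℤ.+ a) ℤ.+ b)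
  facetEq = begin
    l ⊛ facetRow                                 ≡⟨ ⊛-+ l (λ t → row t ℤ.+ row t) baseTag ⟩
    l ⊛ (λ t → row t ℤ.+ row t) ℚ.+ l ⊛ baseTag  ≡⟨ cong (ℚ._+ l ⊛ baseTag) (⊛-+ l row row) ⟩
    (l ⊛ row ℚ.+ l ⊛ row) ℚ.+ l ⊛ baseTag        ≡⟨ cong₂ ℚ._+_ (cong₂ ℚ._+_ a-hull a-hull) (hull zero) ⟩
    (ℤ→ℚ a ℚ.+ ℤ→ℚ a) ℚ.+ ℤ→ℚ b                  ≡⟨ cong (ℚ._+ ℤ→ℚ b) (sym (ℤ→ℚ-homo-+ a a)) ⟩
    ℤ→ℚ (a ℤ.+ a) ℚ.+ ℤ→ℚ b                      ≡⟨ sym (ℤ→ℚ-homo-+ (a ℤ.+ a) b) ⟩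
    ℤ→ℚ ((a ℤ.+ a) ℤ.+ b)                        ∎
    where
    open ≡-Reasoning
    a-hull = hull (suc zero)
  a-bounds = convex-integral-bounds cw row (from-yes (all? λ t → + 0 ℤ.≤? row t))
    (from-yes (all? λ t → row t ℤ.≤? + 2)) (hull (suc zero))
  b-bounds = convex-integral-bounds cw baseTag (from-yes (all? λ t → + 0 ℤ.≤? baseTag t))
    (from-yes (all? λ t → baseTag t ℤ.≤? + 2)) (hull zero)
  facet = proj₂ (convex-integral-bounds cw facetRow (from-yes (all? λ t → + 0 ℤ.≤? facetRow t))
    (from-yes (all? λ t → facetRow t ℤ.≤? + 4)) facetEq)
  correct = basePoint-correctℤ (proj₁ a-bounds) (proj₂ a-bounds) (proj₁ b-bounds) (proj₂ b-bounds) facet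

base-distinctColumns : DistinctColumns (baseTag ∷ base)
base-distinctColumns j j′ same = begin
  j                                      ≡⟨ sym (basePoint-inverse j) ⟩
  basePoint (baseRowℕ j) (baseTagℕ j)    ≡⟨ cong₂ basePoint (ℤP.+-injective (same 1F)) (ℤP.+-injective (same 0F)) ⟩
  basePoint (baseRowℕ j′) (baseTagℕ j′)  ≡⟨ basePoint-inverse j′ ⟩
  j′                                     ∎
  where open ≡-Reasoning

base-fullRowRank : FullRowRank base
base-fullRowRank y ⊥y zero = trans (sym (trans (ℚP.+-identityʳ _) (ℚP.*-identityʳ (y zero)))) (⊥y 3F)

base-nonneg : Entrywise (+ 0 ℤ.≤_) (baseTag ∷ base)
base-nonneg = from-yes (all? λ i → all? λ j → + 0 ℤ.≤? (baseTag ∷ base) i j)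

base-bounded : Entrywise (λ a → ℤ.∣ a ∣ ≤ 2) (baseTag ∷ base)
base-bounded = from-yes (all? λ i → all? λ j → ℤ.∣ (baseTag ∷ base) i j ∣ ≤? 2)

Solves : ∀ {m n} → Matrix m n → (Fin m → ℤ) → (Fin n → ℤ) → Set
Solves A b x = ∀ i → A i ⊙ x ≡ b i

baseSol : ℕ → ℕ → Fin 7 → ℤ
baseSol m x = + x ∷ + (m ∸ x) ∷ 0ᵥ

base-solves : ∀ m x → Solves base 0ᵥ (baseSol m x) × baseTag ⊙ baseSol m x ≡ + (m ∸ x)
base-solves m x = (λ where zero → refl) , (begin
  baseTag ⊙ baseSol m x                   ≡⟨ ⊙-0∷ (tail baseTag) (baseSol m x) ⟩
  tail baseTag ⊙ (+ (m ∸ x) ∷ 0ᵥ)         ≡⟨ ⊙-1∷ (tail (tail baseTag)) (+ (m ∸ x) ∷ 0ᵥ) ⟩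
  + (m ∸ x) ℤ.+ tail (tail baseTag) ⊙ 0ᵥ  ≡⟨ cong (ℤ._+_ (+ (m ∸ x))) (⊙-0ᵥʳ (tail (tail baseTag))) ⟩
  + (m ∸ x) ℤ.+ + 0                       ≡⟨ ℤP.+-identityʳ _ ⟩
  + (m ∸ x)                               ∎)
  where open ≡-Reasoning

module _ {m n} (c : ℤ) (M : Matrix m n) (v : Fin n → ℤ) where

  stage-solves : ∀ {b x′} r x → Solves M b x′ → c ℤ.* + x ℤ.+ v ⊙ x′ ≡ + r → x ≤ r →
    Solves (stage c M v) (+ r ∷ + r ∷ b) (+ (r ∸ x) ∷ + x ∷ x′)
  stage-solves {x′ = x′} r x solves row₁ x≤r = λ where
      zero          → trans (stage-row₀-⊙ c M v sol) (cong +_ (ℕP.m∸n+n≡m x≤r))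
      (suc zero)    → trans (stage-row₁-⊙ c M v sol) row₁
      (suc (suc i)) → trans (stage-rowᵣ-⊙ c M v i sol) (solves i)
    where
    sol : Fin (suc (suc n)) → ℤ
    sol = + (r ∸ x) ∷ + x ∷ x′

  stage-solves-inner : ∀ {r₀ r₁ b x} → Solves (stage c M v) (r₀ ∷ r₁ ∷ b) x → Solves M b (tail (tail x))
  stage-solves-inner {x = x} solves i = trans (sym (stage-rowᵣ-⊙ c M v i x)) (solves (suc (suc i)))

stage-e₀-x₃≡c*x₁ : ∀ {m n} c c′ (M : Matrix m n) v {r₀ r b} x →
  Solves (stage c (stage c′ M v) e₀) (r₀ ∷ r ∷ r ∷ b) x → x 3F ≡ c ℤ.* x 1F
stage-e₀-x₃≡c*x₁ c c′ M v {r = r} x solves = +-cancelˡ-≡ (x 2F) (x 3F) (c ℤ.* x 1F) (begin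
  x 2F ℤ.+ x 3F                      ≡⟨ sym (stage-row₀-⊙ c′ M v (tail (tail x))) ⟩
  stage c′ M v zero ⊙ tail (tail x)  ≡⟨ stage-solves-inner c (stage c′ M v) e₀ {x = x} solves zero ⟩
  r                                  ≡⟨ sym (solves 1F) ⟩
  stage c (stage c′ M v) e₀ 1F ⊙ x   ≡⟨ stage-row₁-⊙ c (stage c′ M v) e₀ x ⟩
  c ℤ.* x 1F ℤ.+ e₀ ⊙ tail (tail x)  ≡⟨ cong (ℤ._+_ (c ℤ.* x 1F)) (⊙-e₀ (tail (tail x))) ⟩
  c ℤ.* x 1F ℤ.+ x 2F                ≡⟨ ℤP.+-comm (c ℤ.* x 1F) (x 2F) ⟩
  x 2F ℤ.+ c ℤ.* x 1F                ∎)
  where open ≡-Reasoning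

sumℚ-ℤ→ℚ-* : ∀ {n} (a u : Fin n → ℤ) q →
  sumℚ (λ j → ℤ→ℚ (a j) ℚ.* (ℤ→ℚ (u j) ℚ.* q)) ≡ ℤ→ℚ (a ⊙ u) ℚ.* q
sumℚ-ℤ→ℚ-* a u q = begin
  sumℚ (λ j → ℤ→ℚ (a j) ℚ.* (ℤ→ℚ (u j) ℚ.* q))
    ≡⟨ sumℚ-cong (λ j → sym (trans (cong (ℚ._* q) (ℤ→ℚ-homo-* (a j) (u j)))
                                   (ℚP.*-assoc (ℤ→ℚ (a j)) (ℤ→ℚ (u j)) q))) ⟩
  sumℚ (λ j → ℤ→ℚ (a j ℤ.* u j) ℚ.* q)
    ≡⟨ sumℚ-*ʳ (λ j → ℤ→ℚ (a j ℤ.* u j)) q ⟩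
  sumℚ (λ j → ℤ→ℚ (a j ℤ.* u j)) ℚ.* q
    ≡⟨ cong (ℚ._* q) (sym (ℤ→ℚ-sumℤ (λ j → a j ℤ.* u j))) ⟩
  ℤ→ℚ (a ⊙ u) ℚ.* q ∎
  where open ≡-Reasoning

∣U*1/suc-X∣≡∣U-suc*X∣*1/suc : ∀ k U X →
  ℚ.∣ ℤ→ℚ U ℚ.* 1/suc k ℚ.- ℤ→ℚ X ∣ ≡ ℤ→ℚ (+ ℤ.∣ U ℤ.- + suc k ℤ.* X ∣) ℚ.* 1/suc k
∣U*1/suc-X∣≡∣U-suc*X∣*1/suc k U X = begin
  ℚ.∣ ℤ→ℚ U ℚ.* r ℚ.- ℤ→ℚ X ∣
    ≡⟨ cong (λ q → ℚ.∣ ℤ→ℚ U ℚ.* r ℚ.- q ∣) X≡ΔXr ⟩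
  ℚ.∣ ℤ→ℚ U ℚ.* r ℚ.- ℤ→ℚ (Δ ℤ.* X) ℚ.* r ∣
    ≡⟨ cong ℚ.∣_∣ (solve 3 (λ a b q → a :* q :- b :* q := (a :- b) :* q) refl (ℤ→ℚ U) (ℤ→ℚ (Δ ℤ.* X)) r) ⟩
  ℚ.∣ (ℤ→ℚ U ℚ.- ℤ→ℚ (Δ ℤ.* X)) ℚ.* r ∣
    ≡⟨ cong (λ q → ℚ.∣ q ℚ.* r ∣) (sym W≡) ⟩
  ℚ.∣ ℤ→ℚ W ℚ.* r ∣
    ≡⟨ ℚP.∣p*q∣≡∣p∣*∣q∣ (ℤ→ℚ W) r ⟩
  ℚ.∣ ℤ→ℚ W ∣ ℚ.* ℚ.∣ r ∣
    ≡⟨ cong₂ ℚ._*_ (ℤ→ℚ-∣∣ W) (ℚP.0≤p⇒∣p∣≡p (ℚ.*≤* (+≤+ z≤n))) ⟩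
  ℤ→ℚ (+ ℤ.∣ W ∣) ℚ.* r ∎
  where
  open ≡-Reasoning
  open +-*-Solver
  r = 1/suc k
  Δ = + suc k
  W = U ℤ.- Δ ℤ.* X
  W≡ : ℤ→ℚ W ≡ ℤ→ℚ U ℚ.- ℤ→ℚ (Δ ℤ.* X)
  W≡ = trans (ℤ→ℚ-homo-+ U (ℤ.- (Δ ℤ.* X))) (cong (ℤ→ℚ U ℚ.+_) (ℤ→ℚ-homo‿- (Δ ℤ.* X)))
  X≡ΔXr : ℤ→ℚ X ≡ ℤ→ℚ (Δ ℤ.* X) ℚ.* r
  X≡ΔXr = sym (ℤ→ℚ-*-1/suc-cancel k X)

P≤∣P⊖B∣ : ∀ {P B} → B ≡ 0 ⊎ P + P ≤ B → P ≤ ℤ.∣ P ℤ.⊖ B ∣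
P≤∣P⊖B∣ {P} (inj₁ refl)  = ℕP.≤-reflexive (cong ℤ.∣_∣ (sym (ℤP.⊖-≥ z≤n)))
P≤∣P⊖B∣ {P} (inj₂ 2P≤B) =
  subst (P ≤_) (sym (ℤP.∣⊖∣-≤ (ℕP.≤-trans (ℕP.m≤m+n P P) 2P≤B))) (ℕP.m+n≤o⇒m≤o∸n P 2P≤B)

P≤∣P-Δ*P*n∣ : ∀ {Δ} P n → 2 ≤ Δ → P ≤ ℤ.∣ + P ℤ.- + Δ ℤ.* (+ P ℤ.* + n) ∣
P≤∣P-Δ*P*n∣ {Δ} P n 2≤Δ = subst (λ w → P ≤ ℤ.∣ w ∣) (sym W≡P⊖B) (P≤∣P⊖B∣ (B≡0⊎2P≤B n))
  where
  W≡P⊖B : + P ℤ.- + Δ ℤ.* (+ P ℤ.* + n) ≡ P ℤ.⊖ (Δ * (P * n))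
  W≡P⊖B = trans (cong (λ w → + P ℤ.- w) (trans (cong (+ Δ ℤ.*_) (sym (ℤP.pos-* P n))) (sym (ℤP.pos-* Δ (P * n)))))
                (ℤP.m-n≡m⊖n P (Δ * (P * n)))
  B≡0⊎2P≤B : ∀ n → Δ * (P * n) ≡ 0 ⊎ P + P ≤ Δ * (P * n)
  B≡0⊎2P≤B zero    = inj₁ (trans (cong (Δ *_) (ℕP.*-zeroʳ P)) (ℕP.*-zeroʳ Δ))
  B≡0⊎2P≤B (suc n) = inj₂ (subst (_≤ Δ * (P * suc n)) (cong (_+_ P) (ℕP.+-identityʳ P))
    (ℕP.*-mono-≤ 2≤Δ (ℕP.m≤m*n P (suc n))))

zeroObj-intSol : ∀ {m n} {A : Matrix m n} {b x} → IntFeasible A b x → IntSol A b zeroObj x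
zeroObj-intSol {x = x} feasible = feasible , λ y _ → ℤP.≤-reflexive (trans (⊙-0ᵥ x) (sym (⊙-0ᵥ y)))

zeroObj-fracSol : ∀ {m n} {A : Matrix m n} {b z} → FracFeasible A b z → FracSol A b zeroObj z
zeroObj-fracSol {z = z} feasible = feasible , λ w _ → ℚP.≤-reflexive (trans (0⊛ z) (sym (0⊛ w)))
  where
  0⊛ : ∀ w → sumℚ (λ j → ℤ→ℚ (zeroObj j) ℚ.* w j) ≡ 0ℚ
  0⊛ w = sumℚ-zero (λ j → ℚP.*-zeroˡ (w j))

∷-nonNegVec : ∀ {n a} {u : Fin n → ℤ} → + 0 ℤ.≤ a → NonNegVec u → NonNegVec (a ∷ u)
∷-nonNegVec 0≤a 0≤u zero    = 0≤a
∷-nonNegVec 0≤a 0≤u (suc j) = 0≤u j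

0ᵥ-nonNegVec : ∀ {n} → NonNegVec (0ᵥ {n})
0ᵥ-nonNegVec _ = +≤+ z≤n

rows : ℕ → ℕ
rows zero    = 1
rows (suc k) = suc (suc (rows k))

ProxLowerBoundInstance : (Δ e N : ℕ) → Set
ProxLowerBoundInstance Δ e N = Σ (Matrix N (N + 6)) λ A → Σ (Fin N → ℤ) λ b →
  NonNegMatrix A × FullRowRank A × MaxAbsEntry A Δ × NonNegVec b × ProxAtLeastPow A b zeroObj Δ e 1 × Polytopish A

module Tower (δ : ℕ) where

  Δ : ℕ
  Δ = suc δ

  towerTag : (k : ℕ) → Fin (rows k + 6) → ℤ
  towerTag zero    = baseTag
  towerTag (suc k) = e₀

  tower : (k : ℕ) → Matrix (rows k) (rows k + 6)
  tower zero    = base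
  tower (suc k) = stage (+ Δ) (tower k) (towerTag k)

  tower-entrywise : ∀ {P : ℤ → Set} → P (+ 0) → P (+ 1) → P (+ Δ) → Entrywise P (baseTag ∷ base) →
    ∀ k → Entrywise P (towerTag k ∷ tower k)
  tower-entrywise         P0 P1 PΔ Pbase zero    = Pbase
  tower-entrywise {P = P} P0 P1 PΔ Pbase (suc k) =
    stage-entrywise {P = P} (+ Δ) (tower k) (towerTag k) P0 P1 PΔ (tower-entrywise {P = P} P0 P1 PΔ Pbase k)

  top-entrywise : ∀ {P : ℤ → Set} → P (+ 0) → P (+ 1) → P (+ Δ) → Entrywise P (baseTag ∷ base) →
    ∀ k → Entrywise P (stage (+ 1) (tower k) (towerTag k))
  top-entrywise {P = P} P0 P1 PΔ Pbase k i =
    stage-entrywise {P = P} (+ 1) (tower k) (towerTag k) P0 P1 P1 (tower-entrywise {P = P} P0 P1 PΔ Pbase k) (suc i)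

  tower-fullRowRank : ∀ k → FullRowRank (tower k)
  tower-fullRowRank zero    = base-fullRowRank
  tower-fullRowRank (suc k) = stage-fullRowRank δ (tower k) (towerTag k) (tower-fullRowRank k)

  tower-latticeClosed : ∀ k → LatticeClosed (towerTag k ∷ tower k)
  tower-latticeClosed zero    = base-latticeClosed
  tower-latticeClosed (suc k) = stage-latticeClosed (+ Δ) (tower k) (towerTag k) (tower-latticeClosed k)

  tower-distinctColumns : ∀ k → DistinctColumns (towerTag k ∷ tower k)
  tower-distinctColumns zero    = base-distinctColumns
  tower-distinctColumns (suc k) = ∷-distinctColumns e₀ _
    (stage-distinctColumns (+ Δ) (tower k) (towerTag k) (λ ()) (tower-distinctColumns k))

  towerRhs : ℕ → (k : ℕ) → Fin (rows k) → ℤ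
  towerRhs r zero    = 0ᵥ
  towerRhs r (suc k) = + r ∷ + r ∷ towerRhs r k

  towerSol : ℕ → (k : ℕ) → ℕ → Fin (rows k + 6) → ℤ
  towerSol r zero    x = baseSol r x
  towerSol r (suc k) x = + (r ∸ x) ∷ + x ∷ towerSol r k (Δ * x)

  x≤Δ^k*x : ∀ k x → x ≤ Δ ^ k * x
  x≤Δ^k*x k x = ℕP.m≤n*m x (Δ ^ k) {{ℕP.m^n≢0 Δ k}}

  towerSol-solves : ∀ r k x → Δ ^ k * x ≤ r →
    Solves (tower k) (towerRhs r k) (towerSol r k x) × towerTag k ⊙ towerSol r k x ≡ + (r ∸ x)
  towerSol-solves r zero    x _     = base-solves r x
  towerSol-solves r (suc k) x bound =
    stage-solves (+ Δ) (tower k) (towerTag k) r x (proj₁ ih) row₁ (ℕP.≤-trans (x≤Δ^k*x (suc k) x) bound) ,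
    ⊙-e₀ (towerSol r (suc k) x)
    where
    bound′ : Δ ^ k * (Δ * x) ≤ r
    bound′ = subst (_≤ r) (trans (cong (_* x) (ℕP.*-comm Δ (Δ ^ k))) (ℕP.*-assoc (Δ ^ k) Δ x)) bound
    ih = towerSol-solves r k (Δ * x) bound′
    row₁ : + Δ ℤ.* + x ℤ.+ towerTag k ⊙ towerSol r k (Δ * x) ≡ + r
    row₁ = begin
      + Δ ℤ.* + x ℤ.+ towerTag k ⊙ towerSol r k (Δ * x)
        ≡⟨ cong₂ ℤ._+_ (sym (ℤP.pos-* Δ x)) (proj₂ ih) ⟩
      + (Δ * x) ℤ.+ + (r ∸ Δ * x)
        ≡⟨ cong +_ (ℕP.m+[n∸m]≡n (ℕP.≤-trans (x≤Δ^k*x k (Δ * x)) bound′)) ⟩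
      + r
        ∎
      where open ≡-Reasoning

  deep : (k : ℕ) → Fin (rows (suc k) + 6)
  deep zero    = 1F
  deep (suc k) = suc (suc (deep k))

  mutual
    tower-rigid : ∀ k {r x} → Solves (tower (suc k)) (towerRhs r (suc k)) x → x (deep k) ≡ + (Δ ^ k) ℤ.* x 1F
    tower-rigid zero            solves = sym (ℤP.*-identityˡ _)
    tower-rigid (suc k) {x = x} solves = begin
      x (deep (suc k))              ≡⟨ stage-rigid (+ Δ) k {x = x} solves ⟩
      + (Δ ^ k) ℤ.* (+ Δ ℤ.* x 1F)  ≡⟨ sym (ℤP.*-assoc (+ (Δ ^ k)) (+ Δ) (x 1F)) ⟩
      (+ (Δ ^ k) ℤ.* + Δ) ℤ.* x 1F  ≡⟨ cong (ℤ._* x 1F) (sym (ℤP.pos-* (Δ ^ k) Δ)) ⟩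
      + (Δ ^ k * Δ) ℤ.* x 1F        ≡⟨ cong (λ a → + a ℤ.* x 1F) (ℕP.*-comm (Δ ^ k) Δ) ⟩
      + (Δ ^ suc k) ℤ.* x 1F        ∎
      where open ≡-Reasoning

    stage-rigid : ∀ c k {r x} → Solves (stage c (tower (suc k)) e₀) (+ r ∷ + r ∷ towerRhs r (suc k)) x →
      x (suc (suc (deep k))) ≡ + (Δ ^ k) ℤ.* (c ℤ.* x 1F)
    stage-rigid c k {x = x} solves =
      trans (tower-rigid k {x = tail (tail x)} (stage-solves-inner c (tower (suc k)) e₀ {x = x} solves))
            (cong (+ (Δ ^ k) ℤ.*_) (stage-e₀-x₃≡c*x₁ c (+ Δ) (tower k) (towerTag k) x solves))

  towerRhs-nonNegVec : ∀ r k → NonNegVec (towerRhs r k)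
  towerRhs-nonNegVec r zero    = 0ᵥ-nonNegVec
  towerRhs-nonNegVec r (suc k) = ∷-nonNegVec (+≤+ z≤n) (∷-nonNegVec (+≤+ z≤n) (towerRhs-nonNegVec r k))

  towerSol-nonNegVec : ∀ r k x → NonNegVec (towerSol r k x)
  towerSol-nonNegVec r zero    x = ∷-nonNegVec (+≤+ z≤n) (∷-nonNegVec (+≤+ z≤n) 0ᵥ-nonNegVec)
  towerSol-nonNegVec r (suc k) x = ∷-nonNegVec (+≤+ z≤n) (∷-nonNegVec (+≤+ z≤n) (towerSol-nonNegVec r k (Δ * x)))

  towerRhs-scale : ∀ r k i → towerRhs (Δ * r) k i ≡ + Δ ℤ.* towerRhs r k i
  towerRhs-scale r zero    i             = sym (ℤP.*-zeroʳ (+ Δ))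
  towerRhs-scale r (suc k) zero          = ℤP.pos-* Δ r
  towerRhs-scale r (suc k) (suc zero)    = ℤP.pos-* Δ r
  towerRhs-scale r (suc k) (suc (suc i)) = towerRhs-scale r k i

  module Instance (K′ : ℕ) where

    K N : ℕ
    K = suc K′
    N = suc (suc (rows K))

    A : Matrix N (N + 6)
    A = stage (+ 1) (tower K) e₀

    rhs : ℕ → Fin N → ℤ
    rhs r = + r ∷ + r ∷ towerRhs r K

    sol : ℕ → ℕ → Fin (N + 6) → ℤ
    sol r x = + (r ∸ x) ∷ + x ∷ towerSol r K x

    sol-feasible : ∀ r x → Δ ^ K * x ≤ r → IntFeasible A (rhs r) (sol r x)
    sol-feasible r x bound =
      ∷-nonNegVec (+≤+ z≤n) (∷-nonNegVec (+≤+ z≤n) (towerSol-nonNegVec r K x)) ,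
      stage-solves (+ 1) (tower K) e₀ {x′ = towerSol r K x} r x (proj₁ inner) row₁ x≤r
      where
      inner = towerSol-solves r K x bound
      x≤r = ℕP.≤-trans (x≤Δ^k*x K x) bound
      row₁ : + 1 ℤ.* + x ℤ.+ e₀ ⊙ towerSol r K x ≡ + r
      row₁ = trans (cong₂ ℤ._+_ (ℤP.*-identityˡ (+ x)) (proj₂ inner)) (cong +_ (ℕP.m+[n∸m]≡n x≤r))

    rhs-scale : ∀ r i → rhs (Δ * r) i ≡ + Δ ℤ.* rhs r i
    rhs-scale r zero          = ℤP.pos-* Δ r
    rhs-scale r (suc zero)    = ℤP.pos-* Δ r
    rhs-scale r (suc (suc i)) = towerRhs-scale r K i

    b : Fin N → ℤ
    b = rhs (Δ ^ K)

    xᴵ : Fin (N + 6) → ℤ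
    xᴵ = sol (Δ ^ K) 1

    uᶠ : Fin (N + 6) → ℤ
    uᶠ = sol (Δ * Δ ^ K) 1

    zᶠ : Fin (N + 6) → ℚ
    zᶠ j = ℤ→ℚ (uᶠ j) ℚ.* 1/suc δ

    xᴵ-feasible : IntFeasible A b xᴵ
    xᴵ-feasible = sol-feasible (Δ ^ K) 1 (ℕP.≤-reflexive (ℕP.*-identityʳ (Δ ^ K)))

    uᶠ-feasible : IntFeasible A (rhs (Δ * Δ ^ K)) uᶠ
    uᶠ-feasible = sol-feasible (Δ * Δ ^ K) 1
      (ℕP.≤-trans (ℕP.≤-reflexive (ℕP.*-identityʳ (Δ ^ K))) (ℕP.m≤n*m (Δ ^ K) Δ))

    zᶠ-feasible : FracFeasible A b zᶠ
    zᶠ-feasible = zᶠ≥0 , rows-ok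
      where
      zᶠ≥0 : ∀ j → 0ℚ ℚ.≤ zᶠ j
      zᶠ≥0 j = subst (ℚ._≤ zᶠ j) (ℚP.*-zeroˡ (1/suc δ))
        (ℚP.*-monoʳ-≤-nonNeg (1/suc δ) (ℤ→ℚ-mono-≤ (proj₁ uᶠ-feasible j)))
      rows-ok : ∀ i → sumℚ (λ j → ℤ→ℚ (A i j) ℚ.* zᶠ j) ≡ ℤ→ℚ (b i)
      rows-ok i = begin
        sumℚ (λ j → ℤ→ℚ (A i j) ℚ.* zᶠ j)
          ≡⟨ sumℚ-ℤ→ℚ-* (A i) uᶠ (1/suc δ) ⟩
        ℤ→ℚ (A i ⊙ uᶠ) ℚ.* 1/suc δ
          ≡⟨ cong (λ a → ℤ→ℚ a ℚ.* 1/suc δ) (trans (proj₂ uᶠ-feasible i) (rhs-scale (Δ ^ K) i)) ⟩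
        ℤ→ℚ (+ Δ ℤ.* b i) ℚ.* 1/suc δ
          ≡⟨ ℤ→ℚ-*-1/suc-cancel δ (b i) ⟩
        ℤ→ℚ (b i) ∎
        where open ≡-Reasoning

    jᵈ : Fin (N + 6)
    jᵈ = suc (suc (deep K′))

    deep-coordinate : ∀ {r x} → Solves A (rhs r) x → x jᵈ ≡ + (Δ ^ K′) ℤ.* x 1F
    deep-coordinate {x = x} solves =
      trans (stage-rigid (+ 1) K′ {x = x} solves) (cong (+ (Δ ^ K′) ℤ.*_) (ℤP.*-identityˡ (x 1F)))

    far : 2 ≤ Δ → ∀ e → suc e ≤ K′ → ∀ x → IntSol A b zeroObj x →
      ∃ λ j → ℕ→ℚ (Δ ^ e) ℚ.≤ (ℚ.∣ zᶠ j ℚ.- ℤ→ℚ (x j) ∣ ^ℚ 1)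
    far 2≤Δ e e<K′ x ((x≥0 , solves) , _) = jᵈ , (begin
      ℤ→ℚ (+ (Δ ^ e))
        ≡⟨ sym (ℤ→ℚ-*-1/suc-cancel δ (+ (Δ ^ e))) ⟩
      ℤ→ℚ (+ Δ ℤ.* + (Δ ^ e)) ℚ.* 1/suc δ
        ≡⟨ cong (λ a → ℤ→ℚ a ℚ.* 1/suc δ) (sym (ℤP.pos-* Δ (Δ ^ e))) ⟩
      ℤ→ℚ (+ (Δ ^ suc e)) ℚ.* 1/suc δ
        ≤⟨ scaled-mono (ℕP.^-monoʳ-≤ Δ e<K′) ⟩
      ℤ→ℚ (+ P) ℚ.* 1/suc δ
        ≤⟨ scaled-mono (P≤∣P-Δ*P*n∣ P n 2≤Δ) ⟩
      ℤ→ℚ (+ ℤ.∣ + P ℤ.- + Δ ℤ.* (+ P ℤ.* + n) ∣) ℚ.* 1/suc δ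
        ≡⟨ sym (∣U*1/suc-X∣≡∣U-suc*X∣*1/suc δ (+ P) (+ P ℤ.* + n)) ⟩
      ℚ.∣ ℤ→ℚ (+ P) ℚ.* 1/suc δ ℚ.- ℤ→ℚ (+ P ℤ.* + n) ∣
        ≡⟨ cong₂ (λ u w → ℚ.∣ ℤ→ℚ u ℚ.* 1/suc δ ℚ.- ℤ→ℚ w ∣) (sym uᶠ-deep) (sym x-deep) ⟩
      ℚ.∣ zᶠ jᵈ ℚ.- ℤ→ℚ (x jᵈ) ∣
        ≡⟨ sym (ℚP.*-identityʳ _) ⟩
      ℚ.∣ zᶠ jᵈ ℚ.- ℤ→ℚ (x jᵈ) ∣ ^ℚ 1
        ∎)
      where
      open ℚP.≤-Reasoning
      P = Δ ^ K′
      n = ℤ.∣ x 1F ∣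
      scaled-mono : ∀ {a c} → a ≤ c → ℤ→ℚ (+ a) ℚ.* 1/suc δ ℚ.≤ ℤ→ℚ (+ c) ℚ.* 1/suc δ
      scaled-mono a≤c = ℚP.*-monoʳ-≤-nonNeg (1/suc δ) (ℤ→ℚ-mono-≤ (+≤+ a≤c))
      uᶠ-deep : uᶠ jᵈ ≡ + P
      uᶠ-deep = trans (deep-coordinate {x = uᶠ} (proj₂ uᶠ-feasible)) (ℤP.*-identityʳ (+ P))
      x-deep : x jᵈ ≡ + P ℤ.* + n
      x-deep = trans (deep-coordinate {x = x} solves) (cong (+ P ℤ.*_) (sym (ℤP.0≤i⇒+∣i∣≡i (x≥0 1F))))

    lowerBoundInstance : 2 ≤ Δ → ∀ e → suc e ≤ K′ → ProxLowerBoundInstance Δ e N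
    lowerBoundInstance 2≤Δ e e<K′ =
      A , b ,
      top-entrywise {P = + 0 ℤ.≤_} (+≤+ z≤n) (+≤+ z≤n) (+≤+ z≤n) base-nonneg K ,
      stage-fullRowRank 0 (tower K) e₀ (tower-fullRowRank K) ,
      (top-entrywise {P = λ a → ℤ.∣ a ∣ ≤ Δ} z≤n 1≤Δ ℕP.≤-refl (λ i j → ℕP.≤-trans (base-bounded i j) 2≤Δ) K ,
       3F , 3F , refl) ,
      ∷-nonNegVec (+≤+ z≤n) (∷-nonNegVec (+≤+ z≤n) (towerRhs-nonNegVec (Δ ^ K) K)) ,
      ((xᴵ , zeroObj-intSol {A = A} xᴵ-feasible) , (zᶠ , zeroObj-fracSol {A = A} {b} zᶠ-feasible , far 2≤Δ e e<K′)) ,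
      polytopish A (top-latticeClosed (tower K) e₀ (tower-latticeClosed K))
        (stage-distinctColumns (+ 1) (tower K) e₀ (λ ()) (tower-distinctColumns K))
      where
      1≤Δ = ℕP.≤-trans (s≤s z≤n) 2≤Δ

rows≡ : ∀ k → rows k ≡ suc (2 * k)
rows≡ zero    = refl
rows≡ (suc k) = trans (cong (λ n → suc (suc n)) (rows≡ k)) (cong suc (sym (ℕP.*-distribˡ-+ 2 1 k)))

odd-dimension : ∀ d → d % 2 ≡ 1 → Σ ℕ λ K′ → suc (suc (rows (suc K′))) ≡ 15 * d × suc d ≤ K′
odd-dimension d d-odd = 15 * h + 5 , N≡15d , d<K′
  where
  open ℕSolver.+-*-Solver
  h = d / 2
  d≡ : d ≡ 1 + h * 2
  d≡ = trans (DivMod.m≡m%n+[m/n]*n d 2) (cong (_+ h * 2) d-odd)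
  N≡15d : suc (suc (rows (suc (15 * h + 5)))) ≡ 15 * d
  N≡15d = begin
    suc (suc (rows (suc (15 * h + 5))))  ≡⟨ cong (λ n → suc (suc n)) (rows≡ (suc (15 * h + 5))) ⟩
    3 + 2 * (1 + (15 * h + 5))           ≡⟨ solve 1 (λ h → con 3 :+ con 2 :* (con 1 :+ (con 15 :* h :+ con 5))
                                                       := con 15 :* (con 1 :+ h :* con 2)) refl h ⟩
    15 * (1 + h * 2)                     ≡⟨ cong (15 *_) (sym d≡) ⟩
    15 * d                               ∎
    where open ≡-Reasoning
  d<K′ : suc d ≤ 15 * h + 5
  d<K′ = subst₂ _≤_ (sym (cong suc d≡))
    (solve 1 (λ h → (con 2 :+ h :* con 2) :+ (con 13 :* h :+ con 3) := con 15 :* h :+ con 5) refl h)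
    (ℕP.m≤m+n (2 + h * 2) (13 * h + 3))

theorem2 : Σ ℕ λ p → Σ ℕ λ q → (1 ≤ p) × (1 ≤ q) ×
    ((Δ d : ℕ) → 2 ≤ Δ → d % 2 ≡ 1 →
      Σ (Matrix (15 * d) (15 * d + 6)) λ A → Σ (Fin (15 * d) → ℤ) λ b →
        NonNegMatrix A × FullRowRank A × MaxAbsEntry A Δ × NonNegVec b
        × ProxAtLeastPow A b zeroObj Δ (p * d) q
        × Polytopish A)
theorem2 = 1 , 1 , ℕP.≤-refl , ℕP.≤-refl , witness
  where
  witness : (Δ d : ℕ) → 2 ≤ Δ → d % 2 ≡ 1 → ProxLowerBoundInstance Δ (1 * d) (15 * d)
  witness (suc δ) d 2≤Δ d-odd =
    let K′ , N≡15d , d<K′ = odd-dimension d d-odd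
    in subst (ProxLowerBoundInstance (suc δ) (1 * d)) N≡15d
         (Tower.Instance.lowerBoundInstance δ K′ 2≤Δ (1 * d)
           (subst (λ e → suc e ≤ K′) (sym (ℕP.*-identityˡ d)) d<K′))
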